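{- Let $n\geq 3$. Define $g_n:T_n\to\mathbb{Z}_{n^2}$ by $$g_n(i,j)=\begin{cases} i-j, & \text{if } i\ge j,\\ i-j+n, & \text{if } i<j,\end{cases}$$ and $f_n:T_n\to\mathbb{Z}_{n^2}$ by $f_n(i,j)=g_n(i,j)+nj$, where elements of $\mathbb{Z}_n$ are identified with their representatives $i,j\in\{0,1,\dots,n-1\}$. Then the array $\mathbf{f}_n=(f_n(i,j))_{(i,j)\in T_n}$ is a balanced array in $\mathbf{A}_n(\mathbb{Z}_{n^2})_{S(n-1)^*}$.
   Context: $\mathbb{Z}_m=\mathbb{Z}/m\mathbb{Z}$. For $n\ge 3$, $T_n=\mathbb{Z}_n\times\mathbb{Z}_n$ (the $n$-torus) and $\mathbf{A}_n(\mathbb{Z}_{n^2})$ is the set of functions $\mathbf{a}:T_n\to\mathbb{Z}_{n^2}$. For $k\ge 2$, $S(k)^*=\{(i_1,i_2)\in\mathbb{Z}^2;0\le i_1,i_2\le k-1\}\setminus\{(0,0)\}$, and $\mathbf{A}_n(\mathbb{Z}_{n^2})_{S(k)^*}$ is the set of $\mathbf{a}\in\mathbf{A}_n(\mathbb{Z}_{n^2})$ such that $\sum_{\mathbf{i}\in S(k)^*}\mathbf{a}_{\mathbf{i}+\mathbf{k}}=0$ in $\mathbb{Z}_{n^2}$ for every $\mathbf{k}\in T_n$ (indices modulo $n$). An array $\mathbf{a}\in\mathbf{A}_n(\mathbb{Z}_{n^2})$ is balanced if $\{\mathbf{a}_{(i,j)};(i,j)\in T_n\}=\mathbb{Z}_{n^2}$,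 i.e. all its values are distinct. -}

module Defs where

open import Data.Nat using (ℕ; zero; suc; _+_; _*_; _∸_; _<_; _≥_; _<ᵇ_; NonZero)
open import Data.Nat.DivMod using (_%_)
open import Data.Fin using (Fin; toℕ; fromℕ<)
open import Data.Nat.DivMod using (m%n<n)
open import Data.Product using (_×_; _,_; ∃)
open import Data.List using (List; []; _∷_; foldr; allFin; concatMap; filterᵇ; map)
open import Data.Bool using (Bool; true; false; if_then_else_; _∧_; not)
open import Relation.Binary.PropositionalEquality using (_≡_)
open import Function.Definitions using (Surjective)
open import Data.Nat.Properties using (m*n≢0)

instance
  sq-nonZero : ∀ {n} .{{_ : NonZero n}} → NonZero (n * n)
  sq-nonZero {n} = m*n≢0 n n

-- ℤ_m is modelled as Fin m (canonical representatives 0..m-1).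
-- Reduction of a natural number modulo m.
[_]ₘ : ∀ {m} .{{_ : NonZero m}} → ℕ → Fin m
[_]ₘ {m} x = fromℕ< (m%n<n x m)

_⊕_ : ∀ {m} .{{_ : NonZero m}} → Fin m → Fin m → Fin m
a ⊕ b = [ toℕ a + toℕ b ]ₘ

0ₘ : ∀ {m} .{{_ : NonZero m}} → Fin m
0ₘ = [ 0 ]ₘ

sumₘ : ∀ {m} .{{_ : NonZero m}} → List (Fin m) → Fin m
sumₘ = foldr _⊕_ 0ₘ

T : ℕ → Set
T n = Fin n × Fin n

Array : ℕ → Set
Array n = T n → Fin (n * n)

-- S(k)* = {(i1,i2) ∈ ℤ² ; 0 ≤ i1,i2 ≤ k-1} \ {(0,0)}, as a list of pairs of naturals
isOrigin : ℕ × ℕ → Bool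
isOrigin (zero , zero) = true
isOrigin _ = false

S* : ℕ → List (ℕ × ℕ)
S* k = filterᵇ (λ p → not (isOrigin p))
         (concatMap (λ i → map (λ j → (toℕ i , toℕ j)) (allFin k)) (allFin k))

shift : ∀ {n} .{{_ : NonZero n}} → ℕ × ℕ → T n → T n
shift (i₁ , i₂) (k₁ , k₂) = [ i₁ + toℕ k₁ ]ₘ , [ i₂ + toℕ k₂ ]ₘ

InKernel : ∀ {n} .{{_ : NonZero n}} → List (ℕ × ℕ) → Array n → Set
InKernel {n} S a = ∀ (k : T n) → sumₘ (map (λ i → a (shift i k)) S) ≡ 0ₘ

-- balanced: every value of ℤ_{n²} is attained (|T_n| = n², so equivalently all values distinct)
Balanced : ∀ {n} → Array n → Set
Balanced a = Surjective _≡_ _≡_ a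

gℕ : ℕ → ℕ → ℕ → ℕ
gℕ n i j = if i <ᵇ j then (i + n) ∸ j else i ∸ j

f : ∀ n .{{_ : NonZero n}} → Array n
f n (i , j) = [ gℕ n (toℕ i) (toℕ j) + n * toℕ j ]ₘ

-- Write g n i j = (i − j) mod n, so f n (i , j) = g n i j + n j, and every
-- residue r + n j arises from exactly one cell, namely ((r + j) mod n , j): f is balanced.
-- For the kernel condition, lift the values to ℕ. Every row of g and every column of g is a
-- permutation of 0 … n − 1, so each row of f sums to t + n t and column j sums to t + n² j,
-- where t = n(n − 1)/2. The (n − 1) × (n − 1) window at (x , y) is the whole torus minus the
-- row x − 1 and the column y − 1, plus their common cell, and g is invariant under translation,
-- so (window) ≡ n + g n x y + n (y − 1) ≡ f n (x , y) modulo n². Removing the origin cell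
-- f n (x , y) from the window leaves a multiple of n².

module Submission where

open import Defs
open import Data.Nat using (ℕ; _≥_; NonZero)
open import Data.Nat using (_∸_)
open import Data.Product using (_×_)

open import Data.Nat using (zero; suc; _+_; _*_; _<_; _≤_; _<ᵇ_; s≤s; z<s; s<s; s≤s⁻¹)
open import Data.Nat.Properties
open import Data.Nat.DivMod
open import Data.Nat.ListAction using (sum)
open import Data.Nat.ListAction.Properties using (sum-++)
open import Data.Nat.Tactic.RingSolver using (solve-∀)
open import Algebra.Properties.CommutativeSemigroup +-commutativeSemigroup
  using () renaming (interchange to +-interchange)
open import Data.Fin using (Fin; toℕ; fromℕ<)
open import Data.Fin.Properties using (toℕ-fromℕ<; toℕ-injective; toℕ<n)
open import Data.Product using (_,_)
open import Data.List using (List; []; _∷_; _++_; map; allFin; concatMap; filterᵇ; tabulate)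
open import Data.List.Properties using (map-++; map-∘; map-cong; map-tabulate)
open import Data.Bool using (Bool; true; false; if_then_else_; not)
open import Function using (id; _∘_)
open import Relation.Nullary.Reflects using (ofʸ; ofⁿ)
open import Relation.Binary.PropositionalEquality
open ≡-Reasoning

∑ : ℕ → (ℕ → ℕ) → ℕ
∑ zero    u = 0
∑ (suc k) u = u 0 + ∑ k (u ∘ suc)

syntax ∑ k (λ a → e) = ∑[ a < k ] e

∑-cong : ∀ k {u v : ℕ → ℕ} → (∀ {a} → a < k → u a ≡ v a) → ∑ k u ≡ ∑ k v
∑-cong zero    e = refl
∑-cong (suc k) e = cong₂ _+_ (e z<s) (∑-cong k (e ∘ s<s))

∑-init-last : ∀ k u → ∑ (suc k) u ≡ ∑ k u + u k
∑-init-last zero    u = +-comm (u 0) 0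
∑-init-last (suc k) u = begin
  u 0 + ∑ (suc k) (u ∘ suc)     ≡⟨ cong (u 0 +_) (∑-init-last k (u ∘ suc)) ⟩
  u 0 + (∑ k (u ∘ suc) + u (suc k)) ≡⟨ +-assoc (u 0) _ _ ⟨
  ∑ (suc k) u + u (suc k)       ∎

∑-distrib-+ : ∀ k u v → ∑[ a < k ] (u a + v a) ≡ ∑ k u + ∑ k v
∑-distrib-+ zero    u v = refl
∑-distrib-+ (suc k) u v = begin
  (u 0 + v 0) + ∑[ a < k ] (u (suc a) + v (suc a))
    ≡⟨ cong ((u 0 + v 0) +_) (∑-distrib-+ k (u ∘ suc) (v ∘ suc)) ⟩
  (u 0 + v 0) + (∑ k (u ∘ suc) + ∑ k (v ∘ suc))
    ≡⟨ +-interchange (u 0) (v 0) _ _ ⟩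
  ∑ (suc k) u + ∑ (suc k) v ∎

*-distribˡ-∑ : ∀ k c u → ∑[ a < k ] (c * u a) ≡ c * ∑ k u
*-distribˡ-∑ zero    c u = sym (*-zeroʳ c)
*-distribˡ-∑ (suc k) c u =
  trans (cong (c * u 0 +_) (*-distribˡ-∑ k c (u ∘ suc))) (sym (*-distribˡ-+ c (u 0) _))

∑-const : ∀ k c → ∑[ _ < k ] c ≡ k * c
∑-const zero    c = refl
∑-const (suc k) c = cong (c +_) (∑-const k c)

∑-rotate : ∀ n .{{_ : NonZero n}} u x → ∑[ a < n ] u ((a + x) % n) ≡ ∑ n u
∑-rotate n u zero =
  ∑-cong n (λ {a} a<n → cong u (trans (cong (_% n) (+-identityʳ a)) (m<n⇒m%n≡m a<n)))
∑-rotate n u (suc x) = begin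
  ∑[ a < n ] u ((a + suc x) % n) ≡⟨ ∑-cong n (λ {a} _ → cong (λ t → u (t % n)) (+-suc a x)) ⟩
  ∑ n (v ∘ suc)                  ≡⟨ +-cancelˡ-≡ (v 0) _ _ shifted ⟩
  ∑ n v                          ≡⟨ ∑-rotate n u x ⟩
  ∑ n u                          ∎
  where
  v : ℕ → ℕ
  v a = u ((a + x) % n)
  shifted : v 0 + ∑ n (v ∘ suc) ≡ v 0 + ∑ n v
  shifted = begin
    ∑ (suc n) v     ≡⟨ ∑-init-last n v ⟩
    ∑ n v + v n     ≡⟨ cong (λ t → ∑ n v + u t) (trans (cong (_% n) (+-comm n x)) ([m+n]%n≡m%n x n)) ⟩
    ∑ n v + v 0     ≡⟨ +-comm _ (v 0) ⟩
    v 0 + ∑ n v     ∎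

∑-reverse : ∀ k v → ∑[ b < suc k ] v (k ∸ b) ≡ ∑ (suc k) v
∑-reverse zero    v = refl
∑-reverse (suc k) v = begin
  v (suc k) + ∑[ b < suc k ] v (k ∸ b) ≡⟨ cong (v (suc k) +_) (∑-reverse k v) ⟩
  v (suc k) + ∑ (suc k) v             ≡⟨ +-comm (v (suc k)) _ ⟩
  ∑ (suc k) v + v (suc k)             ≡⟨ ∑-init-last (suc k) v ⟨
  ∑ (suc (suc k)) v                   ∎

∑-id-twice : ∀ k → ∑ (suc k) id + ∑ (suc k) id ≡ suc k * k
∑-id-twice zero    = refl
∑-id-twice (suc k) = begin
  ∑ (2 + k) id + ∑ (2 + k) id     ≡⟨ cong₂ _+_ (∑-init-last (suc k) id) (∑-init-last (suc k) id) ⟩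
  (t + suc k) + (t + suc k)       ≡⟨ +-interchange t (suc k) t (suc k) ⟩
  (t + t) + (suc k + suc k)       ≡⟨ cong (_+ (suc k + suc k)) (∑-id-twice k) ⟩
  suc k * k + (suc k + suc k)     ≡⟨ expand k ⟩
  (2 + k) * suc k                 ∎
  where
  t = ∑ (suc k) id
  expand : ∀ k → suc k * k + (suc k + suc k) ≡ (2 + k) * suc k
  expand = solve-∀

∑∑-init-last : ∀ K (H : ℕ → ℕ → ℕ) →
  ∑[ a < suc K ] ∑ (suc K) (H a) + H K K
    ≡ (∑[ a < K ] ∑ K (H a) + ∑ (suc K) (H K)) + ∑[ a < suc K ] H a K
∑∑-init-last K H = begin
  ∑[ a < suc K ] ∑ (suc K) (H a) + H K K
    ≡⟨ cong (_+ H K K) (∑-cong (suc K) (λ {a} _ → ∑-init-last K (H a))) ⟩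
  ∑[ a < suc K ] (∑ K (H a) + H a K) + H K K
    ≡⟨ cong (_+ H K K) (∑-distrib-+ (suc K) (λ a → ∑ K (H a)) (λ a → H a K)) ⟩
  (∑[ a < suc K ] ∑ K (H a) + R) + H K K
    ≡⟨ cong (λ s → (s + R) + H K K) (∑-init-last K (λ a → ∑ K (H a))) ⟩
  ((B + ∑ K (H K)) + R) + H K K
    ≡⟨ regroup B (∑ K (H K)) R (H K K) ⟩
  (B + (∑ K (H K) + H K K)) + R
    ≡⟨ cong (λ s → (B + s) + R) (∑-init-last K (H K)) ⟨
  (B + ∑ (suc K) (H K)) + R ∎
  where
  B = ∑[ a < K ] ∑ K (H a)
  R = ∑[ a < suc K ] H a K
  regroup : ∀ b c r h → ((b + c) + r) + h ≡ (b + (c + h)) + r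
  regroup = solve-∀

[m%n+o]%n≡[m+o]%n : ∀ m o n .{{_ : NonZero n}} → (m % n + o) % n ≡ (m + o) % n
[m%n+o]%n≡[m+o]%n m o n = begin
  (m % n + o) % n         ≡⟨ %-distribˡ-+ (m % n) o n ⟩
  (m % n % n + o % n) % n ≡⟨ cong (λ t → (t + o % n) % n) (m%n%n≡m%n m n) ⟩
  (m % n + o % n) % n     ≡⟨ %-distribˡ-+ m o n ⟨
  (m + o) % n             ∎

[m+o%n]%n≡[m+o]%n : ∀ m o n .{{_ : NonZero n}} → (m + o % n) % n ≡ (m + o) % n
[m+o%n]%n≡[m+o]%n m o n = begin
  (m + o % n) % n ≡⟨ cong (_% n) (+-comm m (o % n)) ⟩
  (o % n + m) % n ≡⟨ [m%n+o]%n≡[m+o]%n o m n ⟩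
  (o + m) % n     ≡⟨ cong (_% n) (+-comm o m) ⟩
  (m + o) % n     ∎

m+k*n≡l*n⇒m%n≡0 : ∀ m k l n .{{_ : NonZero n}} → m + k * n ≡ l * n → m % n ≡ 0
m+k*n≡l*n⇒m%n≡0 m k l n eq = begin
  m % n           ≡⟨ [m+kn]%n≡m%n m k n ⟨
  (m + k * n) % n ≡⟨ cong (_% n) eq ⟩
  (l * n) % n     ≡⟨ m*n%n≡0 l n ⟩
  0               ∎

toℕ-sumₘ : ∀ {m} .{{_ : NonZero m}} (xs : List (Fin m)) → toℕ (sumₘ xs) ≡ sum (map toℕ xs) % m
toℕ-sumₘ {m} []       = toℕ-fromℕ< (m%n<n 0 m)
toℕ-sumₘ {m} (x ∷ xs) = begin
  toℕ (x ⊕ sumₘ xs)                 ≡⟨ toℕ-fromℕ< _ ⟩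
  (toℕ x + toℕ (sumₘ xs)) % m       ≡⟨ cong (λ t → (toℕ x + t) % m) (toℕ-sumₘ xs) ⟩
  (toℕ x + sum (map toℕ xs) % m) % m ≡⟨ [m+o%n]%n≡[m+o]%n (toℕ x) _ m ⟩
  (toℕ x + sum (map toℕ xs)) % m    ∎

sum-map-filterᵇ : ∀ {A : Set} (p : A → Bool) (h : A → ℕ) xs →
  sum (map h (filterᵇ p xs)) ≡ sum (map (λ x → if p x then h x else 0) xs)
sum-map-filterᵇ p h []       = refl
sum-map-filterᵇ p h (x ∷ xs) with p x
... | true  = cong (h x +_) (sum-map-filterᵇ p h xs)
... | false = sum-map-filterᵇ p h xs

sum-map-concatMap : ∀ {A B : Set} (g : A → List B) (h : B → ℕ) xs →
  sum (map h (concatMap g xs)) ≡ sum (map (λ x → sum (map h (g x))) xs)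
sum-map-concatMap g h []       = refl
sum-map-concatMap g h (x ∷ xs) = begin
  sum (map h (g x ++ concatMap g xs))               ≡⟨ cong sum (map-++ h (g x) _) ⟩
  sum (map h (g x) ++ map h (concatMap g xs))       ≡⟨ sum-++ (map h (g x)) _ ⟩
  sum (map h (g x)) + sum (map h (concatMap g xs))  ≡⟨ cong (_ +_) (sum-map-concatMap g h xs) ⟩
  sum (map (λ x → sum (map h (g x))) (x ∷ xs))      ∎

sum-tabulate : ∀ k (u : ℕ → ℕ) → sum (tabulate {n = k} (u ∘ toℕ)) ≡ ∑ k u
sum-tabulate zero    u = refl
sum-tabulate (suc k) u = cong (u 0 +_) (sum-tabulate k (u ∘ suc))

sum-map-allFin : ∀ k (u : ℕ → ℕ) → sum (map (u ∘ toℕ) (allFin k)) ≡ ∑ k u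
sum-map-allFin k u = trans (cong sum (map-tabulate {n = k} id (u ∘ toℕ))) (sum-tabulate k u)

sum-map-S* : ∀ k (h : ℕ × ℕ → ℕ) →
  sum (map h (S* (suc k))) + h (0 , 0) ≡ ∑[ a < suc k ] ∑[ b < suc k ] h (a , b)
sum-map-S* k h = begin
  sum (map h (S* (suc k))) + h (0 , 0)
    ≡⟨ cong (_+ h (0 , 0)) (sum-map-filterᵇ (not ∘ isOrigin) h grid) ⟩
  sum (map h′ grid) + h (0 , 0)
    ≡⟨ cong (_+ h (0 , 0)) (sum-map-concatMap row h′ (allFin (suc k))) ⟩
  sum (map (λ i → sum (map h′ (row i))) (allFin (suc k))) + h (0 , 0)
    ≡⟨ cong (λ rs → sum rs + h (0 , 0)) (map-cong row-sum (allFin (suc k))) ⟩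
  sum (map (λ i → ∑[ b < suc k ] h′ (toℕ i , b)) (allFin (suc k))) + h (0 , 0)
    ≡⟨ cong (_+ h (0 , 0)) (sum-map-allFin (suc k) (λ a → ∑[ b < suc k ] h′ (a , b))) ⟩
  ∑[ a < suc k ] ∑[ b < suc k ] h′ (a , b) + h (0 , 0)
    ≡⟨ restore-origin (∑[ b < k ] h (0 , suc b)) (∑[ a < k ] ∑[ b < suc k ] h (suc a , b)) (h (0 , 0)) ⟩
  ∑[ a < suc k ] ∑[ b < suc k ] h (a , b) ∎
  where
  h′ : ℕ × ℕ → ℕ
  h′ q = if not (isOrigin q) then h q else 0
  row : Fin (suc k) → List (ℕ × ℕ)
  row i = map (λ j → (toℕ i , toℕ j)) (allFin (suc k))
  grid : List (ℕ × ℕ)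
  grid = concatMap row (allFin (suc k))
  row-sum : ∀ i → sum (map h′ (row i)) ≡ ∑[ b < suc k ] h′ (toℕ i , b)
  row-sum i = trans (cong sum (sym (map-∘ (allFin (suc k))))) (sum-map-allFin (suc k) (λ b → h′ (toℕ i , b)))
  -- Once both sums are unfolded, h′ (0 , 0) is 0 and h′ agrees with h elsewhere by computation.
  restore-origin : ∀ r c o → (0 + r + c) + o ≡ (o + r) + c
  restore-origin = solve-∀

gℕ≡[i+[n∸j]]%n : ∀ {n} .{{_ : NonZero n}} {i j} → i < n → j ≤ n → gℕ n i j ≡ (i + (n ∸ j)) % n
gℕ≡[i+[n∸j]]%n {n} {i} {j} i<n j≤n with i <ᵇ j | <ᵇ-reflects-< i j
... | true  | ofʸ i<j = begin
  i + n ∸ j         ≡⟨ +-∸-assoc i j≤n ⟩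
  i + (n ∸ j)       ≡⟨ m<n⇒m%n≡m i+[n∸j]<n ⟨
  (i + (n ∸ j)) % n ∎
  where
  i+[n∸j]<n : i + (n ∸ j) < n
  i+[n∸j]<n = subst (i + (n ∸ j) <_) (m+[n∸m]≡n j≤n) (+-monoˡ-< (n ∸ j) i<j)
... | false | ofⁿ i≮j = begin
  i ∸ j                   ≡⟨ m<n⇒m%n≡m (≤-<-trans (m∸n≤m i j) i<n) ⟨
  (i ∸ j) % n             ≡⟨ [m+n]%n≡m%n (i ∸ j) n ⟨
  (i ∸ j + n) % n         ≡⟨ cong (_% n) (+-∸-comm n j≤i) ⟨
  (i + n ∸ j) % n         ≡⟨ cong (_% n) (+-∸-assoc i j≤n) ⟩
  (i + (n ∸ j)) % n       ∎
  where
  j≤i : j ≤ i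
  j≤i = ≮⇒≥ i≮j

gℕ<n : ∀ {n} .{{_ : NonZero n}} {i j} → i < n → j ≤ n → gℕ n i j < n
gℕ<n {n} {i} {j} i<n j≤n = subst (_< n) (sym (gℕ≡[i+[n∸j]]%n i<n j≤n)) (m%n<n (i + (n ∸ j)) n)

[gℕ+j]%n≡i : ∀ {n} .{{_ : NonZero n}} {i j} → i < n → j ≤ n → (gℕ n i j + j) % n ≡ i
[gℕ+j]%n≡i {n} {i} {j} i<n j≤n = begin
  (gℕ n i j + j) % n           ≡⟨ cong (λ g → (g + j) % n) (gℕ≡[i+[n∸j]]%n i<n j≤n) ⟩
  ((i + (n ∸ j)) % n + j) % n  ≡⟨ [m%n+o]%n≡[m+o]%n (i + (n ∸ j)) j n ⟩
  (i + (n ∸ j) + j) % n        ≡⟨ cong (_% n) (trans (+-assoc i _ j) (cong (i +_) (m∸n+n≡m j≤n))) ⟩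
  (i + n) % n                  ≡⟨ [m+n]%n≡m%n i n ⟩
  i % n                        ≡⟨ m<n⇒m%n≡m i<n ⟩
  i                            ∎

gℕ-unique : ∀ {n} .{{_ : NonZero n}} {i j r} → r < n → j ≤ n → (r + j) % n ≡ i → gℕ n i j ≡ r
gℕ-unique {n} {i} {j} {r} r<n j≤n refl = begin
  gℕ n ((r + j) % n) j          ≡⟨ gℕ≡[i+[n∸j]]%n (m%n<n (r + j) n) j≤n ⟩
  ((r + j) % n + (n ∸ j)) % n   ≡⟨ [m%n+o]%n≡[m+o]%n (r + j) (n ∸ j) n ⟩
  (r + j + (n ∸ j)) % n         ≡⟨ cong (_% n) (trans (+-assoc r j _) (cong (r +_) (m+[n∸m]≡n j≤n))) ⟩
  (r + n) % n                   ≡⟨ [m+n]%n≡m%n r n ⟩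
  r % n                         ≡⟨ m<n⇒m%n≡m r<n ⟩
  r                             ∎

gℕ-translate : ∀ {n} .{{_ : NonZero n}} c {i j} → i < n → j < n →
  gℕ n ((c + i) % n) ((c + j) % n) ≡ gℕ n i j
gℕ-translate {n} c {i} {j} i<n j<n =
  gℕ-unique (gℕ<n i<n (<⇒≤ j<n)) (<⇒≤ (m%n<n (c + j) n)) (begin
    (g + (c + j) % n) % n ≡⟨ [m+o%n]%n≡[m+o]%n g (c + j) n ⟩
    (g + (c + j)) % n     ≡⟨ cong (_% n) (trans (+-comm g _) (+-assoc c j g)) ⟩
    (c + (j + g)) % n     ≡⟨ cong (λ t → (c + t) % n) (+-comm j g) ⟩
    (c + (g + j)) % n     ≡⟨ [m+o%n]%n≡[m+o]%n c (g + j) n ⟨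
    (c + (g + j) % n) % n ≡⟨ cong (λ t → (c + t) % n) ([gℕ+j]%n≡i i<n (<⇒≤ j<n)) ⟩
    (c + i) % n           ∎)
  where
  g = gℕ n i j

∑-gℕ-column : ∀ {n} .{{_ : NonZero n}} {j} → j ≤ n → ∑[ a < n ] gℕ n a j ≡ ∑ n id
∑-gℕ-column {n} {j} j≤n =
  trans (∑-cong n (λ a<n → gℕ≡[i+[n∸j]]%n a<n j≤n)) (∑-rotate n id (n ∸ j))

∑-gℕ-row : ∀ {n} .{{_ : NonZero n}} {i} → i < n → ∑[ b < n ] gℕ n i b ≡ ∑ n id
∑-gℕ-row {suc k} {i} i<n = begin
  ∑[ b < suc k ] gℕ (suc k) i b         ≡⟨ ∑-cong (suc k) (λ b<n → trans (gℕ≡[i+[n∸j]]%n i<n (<⇒≤ b<n)) (cong (_% suc k) (reflect (s≤s⁻¹ b<n)))) ⟩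
  ∑[ b < suc k ] ((k ∸ b + suc i) % suc k) ≡⟨ ∑-reverse k (λ c → (c + suc i) % suc k) ⟩
  ∑[ c < suc k ] ((c + suc i) % suc k)  ≡⟨ ∑-rotate (suc k) id (suc i) ⟩
  ∑ (suc k) id                          ∎
  where
  reflect : ∀ {b} → b ≤ k → i + (suc k ∸ b) ≡ k ∸ b + suc i
  reflect {b} b≤k = begin
    i + (suc k ∸ b)   ≡⟨ cong (i +_) (+-∸-assoc 1 b≤k) ⟩
    i + suc (k ∸ b)   ≡⟨ +-suc i (k ∸ b) ⟩
    suc (i + (k ∸ b)) ≡⟨ cong suc (+-comm i (k ∸ b)) ⟩
    suc (k ∸ b + i)   ≡⟨ +-suc (k ∸ b) i ⟨
    k ∸ b + suc i     ∎

fℕ : ℕ → ℕ → ℕ → ℕ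
fℕ n i j = gℕ n i j + n * j

fℕ<n*n : ∀ {n} .{{_ : NonZero n}} {i j} → i < n → j < n → fℕ n i j < n * n
fℕ<n*n {n} {i} {j} i<n j<n = <-≤-trans (+-monoˡ-< (n * j) (gℕ<n i<n (<⇒≤ j<n)))
  (subst (_≤ n * n) (*-suc n j) (*-monoʳ-≤ n j<n))

toℕ-f : ∀ n .{{_ : NonZero n}} (i j : Fin n) → toℕ (f n (i , j)) ≡ fℕ n (toℕ i) (toℕ j)
toℕ-f n i j = trans (toℕ-fromℕ< _) (m<n⇒m%n≡m (fℕ<n*n (toℕ<n i) (toℕ<n j)))

f-balanced : ∀ n .{{_ : NonZero n}} → Balanced (f n)
f-balanced n v = (fromℕ< (m%n<n (r + j) n) , fromℕ< j<n) , λ { refl → toℕ-injective (begin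
  toℕ (f n (fromℕ< _ , fromℕ< j<n)) ≡⟨ toℕ-f n _ _ ⟩
  fℕ n (toℕ (fromℕ< _)) (toℕ (fromℕ< j<n)) ≡⟨ cong₂ (fℕ n) (toℕ-fromℕ< _) (toℕ-fromℕ< j<n) ⟩
  gℕ n ((r + j) % n) j + n * j  ≡⟨ cong (_+ n * j) (gℕ-unique (m%n<n t n) (<⇒≤ j<n) refl) ⟩
  r + n * j                     ≡⟨ cong (r +_) (*-comm n j) ⟩
  r + j * n                     ≡⟨ m≡m%n+[m/n]*n t n ⟨
  t                             ∎) }
  where
  t = toℕ v
  r = t % n
  j = t / n
  j<n : j < n
  j<n = m<n*o⇒m/o<n (toℕ<n v)

∑-fℕ-row : ∀ {n} .{{_ : NonZero n}} {i} → i < n → ∑[ b < n ] fℕ n i b ≡ ∑ n id + n * ∑ n id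
∑-fℕ-row {n} {i} i<n = begin
  ∑[ b < n ] fℕ n i b                       ≡⟨ ∑-distrib-+ n (gℕ n i) (n *_) ⟩
  ∑[ b < n ] gℕ n i b + ∑[ b < n ] (n * b)  ≡⟨ cong₂ _+_ (∑-gℕ-row i<n) (*-distribˡ-∑ n n id) ⟩
  ∑ n id + n * ∑ n id                       ∎

∑-fℕ-column : ∀ {n} .{{_ : NonZero n}} {j} → j ≤ n → ∑[ a < n ] fℕ n a j ≡ ∑ n id + n * (n * j)
∑-fℕ-column {n} {j} j≤n = begin
  ∑[ a < n ] fℕ n a j                         ≡⟨ ∑-distrib-+ n (λ a → gℕ n a j) (λ _ → n * j) ⟩
  ∑[ a < n ] gℕ n a j + ∑[ _ < n ] (n * j)    ≡⟨ cong₂ _+_ (∑-gℕ-column j≤n) (∑-const n (n * j)) ⟩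
  ∑ n id + n * (n * j)                        ∎

-- The hypotheses are the identity ∑∑-init-last for the shifted values of f, with t = ∑ n id,
-- G = g n x y, y′ = (y − 1) mod n and S the sum over the window without its origin.
window%n²≡0 : ∀ n .{{_ : NonZero n}} {S G t K y y′ c} →
  t + t ≡ n * K → K + y ≡ y′ + c * n →
  n * (t + n * t) + (G + n * y′) ≡ ((S + (G + n * y)) + (t + n * t)) + (t + n * (n * y′)) →
  S % (n * n) ≡ 0
window%n²≡0 n {S} {G} {t} {K} {y} {y′} {c} 2t≡nK K+y≡y′+cn border =
  m+k*n≡l*n⇒m%n≡0 S (c + y′) t (n * n) (+-cancelʳ-≡ Z _ _ (begin
    (S + (c + y′) * (n * n)) + Z              ≡⟨ expand₁ n S G t y′ c ⟩
    R + n * (y′ + c * n)                      ≡⟨ cong (λ z → R + n * z) K+y≡y′+cn ⟨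
    R + n * (K + y)                           ≡⟨ cong (R +_) (*-distribˡ-+ n K y) ⟩
    R + (n * K + n * y)                       ≡⟨ cong (λ z → R + (z + n * y)) 2t≡nK ⟨
    R + ((t + t) + n * y)                     ≡⟨ expand₂ n S G t y y′ ⟩
    ((S + (G + n * y)) + (t + n * t)) + (t + n * (n * y′)) ≡⟨ border ⟨
    n * (t + n * t) + (G + n * y′)            ≡⟨ expand₃ n G t y′ ⟩
    t * (n * n) + Z                           ∎))
  where
  Z = G + n * y′ + n * t
  R = S + G + n * t + n * (n * y′)
  expand₁ : ∀ n S G t y′ c →
    (S + (c + y′) * (n * n)) + (G + n * y′ + n * t) ≡ (S + G + n * t + n * (n * y′)) + n * (y′ + c * n)
  expand₁ = solve-∀
  expand₂ : ∀ n S G t y y′ →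
    (S + G + n * t + n * (n * y′)) + ((t + t) + n * y) ≡ ((S + (G + n * y)) + (t + n * t)) + (t + n * (n * y′))
  expand₂ = solve-∀
  expand₃ : ∀ n G t y′ → n * (t + n * t) + (G + n * y′) ≡ t * (n * n) + (G + n * y′ + n * t)
  expand₃ = solve-∀

sum-S*-fℕ%n²≡0 : ∀ n .{{_ : NonZero n}} {x y} → 2 ≤ n → x < n → y < n →
  sum (map (λ (a , b) → fℕ n ((a + x) % n) ((b + y) % n)) (S* (n ∸ 1))) % (n * n) ≡ 0
sum-S*-fℕ%n²≡0 (suc (suc k)) {x} {y} (s≤s (s≤s _)) x<n y<n =
  window%n²≡0 n {S} {G} {t} {K} {y} {y′} {(K + y) / n} (∑-id-twice K) (m≡m%n+[m/n]*n (K + y) n) (begin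
    n * (t + n * t) + (G + n * y′)
      ≡⟨ cong₂ _+_ full corner ⟨
    ∑[ a < n ] ∑ n (H a) + H K K
      ≡⟨ ∑∑-init-last K H ⟩
    (∑[ a < K ] ∑ K (H a) + ∑ n (H K)) + ∑[ a < n ] H a K
      ≡⟨ cong₂ _+_ (cong₂ _+_ window (row (m%n<n (K + x) n))) column ⟩
    ((S + (G + n * y)) + (t + n * t)) + (t + n * (n * y′)) ∎)
  where
  K = suc k
  n = suc K
  t = ∑ n id
  G = gℕ n x y
  y′ = (K + y) % n
  H : ℕ → ℕ → ℕ
  H a b = fℕ n ((a + x) % n) ((b + y) % n)
  S = sum (map (λ (a , b) → H a b) (S* K))
  row : ∀ {i} → i < n → ∑[ b < n ] fℕ n i ((b + y) % n) ≡ t + n * t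
  row i<n = trans (∑-rotate n (fℕ n _) y) (∑-fℕ-row i<n)
  full : ∑[ a < n ] ∑ n (H a) ≡ n * (t + n * t)
  full = trans (∑-cong n (λ {a} _ → row (m%n<n (a + x) n))) (∑-const n (t + n * t))
  column : ∑[ a < n ] H a K ≡ t + n * (n * y′)
  column = trans (∑-rotate n (λ i → fℕ n i y′) x) (∑-fℕ-column (<⇒≤ (m%n<n (K + y) n)))
  corner : H K K ≡ G + n * y′
  corner = cong (_+ n * y′) (gℕ-translate K x<n y<n)
  window : ∑[ a < K ] ∑ K (H a) ≡ S + (G + n * y)
  window = begin
    ∑[ a < K ] ∑ K (H a)   ≡⟨ sum-map-S* k (λ (a , b) → H a b) ⟨
    S + H 0 0              ≡⟨ cong₂ (λ i j → S + fℕ n i j) (m<n⇒m%n≡m x<n) (m<n⇒m%n≡m y<n) ⟩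
    S + (G + n * y)        ∎

f-inKernel : ∀ n .{{_ : NonZero n}} → 2 ≤ n → InKernel (S* (n ∸ 1)) (f n)
f-inKernel n 2≤n (X , Y) = toℕ-injective (begin
  toℕ (sumₘ (map value S))            ≡⟨ toℕ-sumₘ (map value S) ⟩
  sum (map toℕ (map value S)) % N     ≡⟨ cong (λ vs → sum vs % N) (map-∘ S) ⟨
  sum (map (toℕ ∘ value) S) % N       ≡⟨ cong (λ vs → sum vs % N) (map-cong toℕ-value S) ⟩
  sum (map shifted-fℕ S) % N          ≡⟨ sum-S*-fℕ%n²≡0 n 2≤n (toℕ<n X) (toℕ<n Y) ⟩
  0                                   ≡⟨ trans (toℕ-fromℕ< _) (m*n%n≡0 0 N) ⟨
  toℕ (0ₘ {N})                        ∎)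
  where
  N = n * n
  S = S* (n ∸ 1)
  value : ℕ × ℕ → Fin N
  value p = f n (shift p (X , Y))
  shifted-fℕ : ℕ × ℕ → ℕ
  shifted-fℕ (a , b) = fℕ n ((a + toℕ X) % n) ((b + toℕ Y) % n)
  toℕ-value : ∀ p → toℕ (value p) ≡ shifted-fℕ p
  toℕ-value (a , b) = trans (toℕ-f n _ _) (cong₂ (fℕ n) (toℕ-fromℕ< _) (toℕ-fromℕ< _))

proposition5p1 : ∀ (n : ℕ) .{{_ : NonZero n}} → n ≥ 3 →
    Balanced (f n) × InKernel (S* (n ∸ 1)) (f n)
proposition5p1 n n≥3 = f-balanced n , f-inKernel n (≤-trans (n≤1+n 2) n≥3)
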